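{- For $n \geq 5$, the Kneser graph $K(n,2)$ satisfies $\mathrm{tp}(K(n,2)) = \mathrm{tp}^-(K(n,2)) = 6$ if $n = 5$, and $\mathrm{tp}(K(n,2)) = \mathrm{tp}^-(K(n,2)) = \lfloor n/2 \rfloor$ if $n \geq 6$.
   Context: The Kneser graph $K(n,2)$ has as vertices the 2-element subsets of $\{1,\dots,n\}$, two being adjacent iff they are disjoint. A set $S \subseteq V(G)$ is in general position if no shortest path of $G$ contains three vertices of $S$. A terminal set of $G$ is a general position set $S$ that is maximal under inclusion and such that for every $u \in V(G)\setminus S$ there is a shortest path of $G$ with $u$ as an endpoint containing at least two vertices of $S$. $\mathrm{tp}(G)$ and $\mathrm{tp}^-(G)$ are the orders of a largest and a smallest terminal set of $G$, respectively. -}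

module Defs where

open import Data.Nat using (ℕ; suc; _≤_)
open import Data.Fin.Subset using (Subset; ∣_∣; _∩_; Empty)
open import Data.Product using (Σ; ∃; _×_; proj₁)
open import Data.Sum using (_⊎_)
open import Data.List using (List; []; _∷_; length)
open import Data.List.Membership.Propositional using (_∈_; _∉_)
open import Data.List.Relation.Unary.Unique.Propositional using (Unique)
open import Relation.Binary.PropositionalEquality using (_≡_; _≢_)
open import Relation.Nullary using (¬_)
open import Data.Empty using (⊥)

-- Vertices of the Kneser graph K(n,2): 2-element subsets of {1..n} (= Fin n).
KV : ℕ → Set
KV n = Σ (Subset n) (λ s → ∣ s ∣ ≡ 2)

Adj : ∀ {n} → KV n → KV n → Set
Adj u v = Empty (proj₁ u ∩ proj₁ v)

data Walk {n : ℕ} : KV n → KV n → Set where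
  [_] : (u : KV n) → Walk u u
  _∷_ : ∀ {u v w} → Adj u v → Walk v w → Walk u w

len : ∀ {n} {u v : KV n} → Walk u v → ℕ
len [ u ] = 0
len (_ ∷ p) = suc (len p)

verts : ∀ {n} {u v : KV n} → Walk u v → List (KV n)
verts [ u ] = u ∷ []
verts (_∷_ {u} _ p) = u ∷ verts p

IsPath : ∀ {n} {u v : KV n} → Walk u v → Set
IsPath p = Unique (verts p)

IsShortestPath : ∀ {n} {u v : KV n} → Walk u v → Set
IsShortestPath {n} {u} {v} p = IsPath p × ((q : Walk u v) → len p ≤ len q)

GenPos : ∀ {n} → List (KV n) → Set
GenPos {n} S =
  ∀ {a b : KV n} (p : Walk a b) → IsShortestPath p →
  ∀ x y z → x ∈ S → y ∈ S → z ∈ S → x ≢ y → y ≢ z → x ≢ z →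
  x ∈ verts p → y ∈ verts p → z ∈ verts p → ⊥

IsTerminal : ∀ {n} → List (KV n) → Set
IsTerminal {n} S =
  Unique S × GenPos S ×
  (∀ u → u ∉ S → ¬ GenPos (u ∷ S)) ×
  (∀ u → u ∉ S →
     Σ (KV n) λ a → Σ (KV n) λ b → Σ (Walk a b) λ p →
       IsShortestPath p × (u ≡ a ⊎ u ≡ b) ×
       Σ (KV n) λ x → Σ (KV n) λ y →
         x ∈ S × y ∈ S × x ≢ y × x ∈ verts p × y ∈ verts p)

IsTp : ℕ → ℕ → Set
IsTp n k = (Σ (List (KV n)) λ S → IsTerminal S × length S ≡ k)
         × (∀ (S : List (KV n)) → IsTerminal S → length S ≤ k)

IsTpMinus : ℕ → ℕ → Set
IsTpMinus n k = (Σ (List (KV n)) λ S → IsTerminal S × length S ≡ k)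
              × (∀ (S : List (KV n)) → IsTerminal S → k ≤ length S)

-- For n ≥ 5 the graph K(n,2) has diameter 2, so a list S is terminal iff it has no repetitions,
-- contains no geodesic u – m – w (u and w meet, m is disjoint from both), and every vertex
-- outside S starts such a geodesic through two members of S.  A terminal set covers all points
-- but at most one, and if it contains two meeting vertices, at most one point outside their union
-- is covered.  For n ≥ 6 there are at least three such outside points, so every terminal set is a
-- matching covering all but at most one point, of size ⌊n/2⌋, and the matching {0,1}, {2,3}, …
-- is terminal.  For n = 5 a terminal matching would have two members, which is impossible, so a
-- terminal set contains two meeting vertices, misses some point h, and is then exactly the set of
-- the six vertices avoiding h, which is terminal.

module Submission where

open import Data.Bool.Properties using () renaming (_≟_ to _≟ᵇ_)
open import Data.Empty using (⊥; ⊥-elim)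
open import Data.Fin using (Fin; zero; suc)
import Data.Fin.Properties as Finₚ
open import Data.Fin.Subset as Subset
  using (Subset; ∣_∣; _∩_; _∪_; ⁅_⁆; ∁; Empty; Nonempty; _⊆_; inside; outside)
  renaming (_∈_ to _∈ₛ_; _∉_ to _∉ₛ_)
open import Data.Fin.Subset.Properties
open import Data.List using (List; []; _∷_; length; map; filter)
open import Data.List.Membership.Propositional using (_∈_; _∉_; find)
open import Data.List.Membership.Propositional.Properties using (∈-++⁺ˡ; ∈-map⁺; ∈-filter⁺; ∈-filter⁻)
open import Data.List.Membership.Propositional.Properties.WithK using (unique∧set⇒bag)
import Data.List.Membership.DecPropositional as Membership
open import Data.List.Relation.Binary.BagAndSetEquality using (∼bag⇒↭)
open import Data.List.Relation.Binary.Permutation.Propositional.Properties using (↭-length)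
open import Data.List.Relation.Unary.All as All using ([]; _∷_)
import Data.List.Relation.Unary.All.Properties as Allₚ
open import Data.List.Relation.Unary.AllPairs as AllPairs using (AllPairs; []; _∷_)
import Data.List.Relation.Unary.AllPairs.Properties as AllPairsₚ
open import Data.List.Relation.Unary.Any as Any using (here; there)
open import Data.List.Relation.Unary.Unique.Propositional using (Unique)
import Data.List.Relation.Unary.Unique.Propositional.Properties as Uniqueₚ
import Data.List.Relation.Unary.Unique.DecPropositional as UniqueDec
open import Data.Nat using (ℕ; zero; suc; _+_; _*_; _∸_; _≤_; _<_; z≤n; s≤s; _/_; _≤?_)
open import Data.Nat.DivMod using (m*n/n≡m; /-monoˡ-≤; m<n*o⇒m/o<n)
open import Data.Nat.Properties
open import Data.Product using (Σ; ∃; ∃₂; _×_; _,_; proj₁; proj₂)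
open import Data.Sum using (_⊎_; inj₁; inj₂) renaming (map to ⊎-map)
open import Data.Vec using ([]; _∷_; here; there)
open import Data.Vec.Properties using (≡-dec)
open import Function using (_∘_; _⇔_; mk⇔)
open import Relation.Binary.Definitions using (DecidableEquality)
open import Relation.Binary.PropositionalEquality
open import Relation.Nullary using (¬_; ¬?; Dec; yes; no)
import Relation.Nullary.Decidable as Dec
open import Relation.Nullary.Decidable using (decidable-stable; toWitness; True)

open import Defs

private variable
  n : ℕ

∣p∪q∣+∣p∩q∣≡∣p∣+∣q∣ : (p q : Subset n) → ∣ p ∪ q ∣ + ∣ p ∩ q ∣ ≡ ∣ p ∣ + ∣ q ∣
∣p∪q∣+∣p∩q∣≡∣p∣+∣q∣ []            []            = refl
∣p∪q∣+∣p∩q∣≡∣p∣+∣q∣ (inside  ∷ p) (inside  ∷ q) =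
  cong suc (trans (+-suc _ _) (trans (cong suc (∣p∪q∣+∣p∩q∣≡∣p∣+∣q∣ p q)) (sym (+-suc _ _))))
∣p∪q∣+∣p∩q∣≡∣p∣+∣q∣ (inside  ∷ p) (outside ∷ q) = cong suc (∣p∪q∣+∣p∩q∣≡∣p∣+∣q∣ p q)
∣p∪q∣+∣p∩q∣≡∣p∣+∣q∣ (outside ∷ p) (inside  ∷ q) =
  trans (cong suc (∣p∪q∣+∣p∩q∣≡∣p∣+∣q∣ p q)) (sym (+-suc _ _))
∣p∪q∣+∣p∩q∣≡∣p∣+∣q∣ (outside ∷ p) (outside ∷ q) = ∣p∪q∣+∣p∩q∣≡∣p∣+∣q∣ p q

Empty[p∩q]⇒∣p∪q∣≡∣p∣+∣q∣ : (p q : Subset n) → Empty (p ∩ q) → ∣ p ∪ q ∣ ≡ ∣ p ∣ + ∣ q ∣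
Empty[p∩q]⇒∣p∪q∣≡∣p∣+∣q∣ {n} p q empty = begin
  ∣ p ∪ q ∣                ≡⟨ sym (+-identityʳ _) ⟩
  ∣ p ∪ q ∣ + 0            ≡⟨ cong (∣ p ∪ q ∣ +_) ∣p∩q∣≡0 ⟨
  ∣ p ∪ q ∣ + ∣ p ∩ q ∣    ≡⟨ ∣p∪q∣+∣p∩q∣≡∣p∣+∣q∣ p q ⟩
  ∣ p ∣ + ∣ q ∣            ∎
  where
  open ≡-Reasoning
  ∣p∩q∣≡0 : ∣ p ∩ q ∣ ≡ 0
  ∣p∩q∣≡0 = trans (cong ∣_∣ (Empty-unique empty)) (∣⊥∣≡0 n)

⊆∧∣p∣≡∣q∣⇒p≡q : {p q : Subset n} → p ⊆ q → ∣ p ∣ ≡ ∣ q ∣ → p ≡ q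
⊆∧∣p∣≡∣q∣⇒p≡q {p = []}          {[]}          _   _  = refl
⊆∧∣p∣≡∣q∣⇒p≡q {p = inside  ∷ p} {inside  ∷ q} p⊆q eq =
  cong (inside ∷_) (⊆∧∣p∣≡∣q∣⇒p≡q (drop-∷-⊆ p⊆q) (suc-injective eq))
⊆∧∣p∣≡∣q∣⇒p≡q {p = inside  ∷ p} {outside ∷ q} p⊆q eq with p⊆q here
... | ()
⊆∧∣p∣≡∣q∣⇒p≡q {p = outside ∷ p} {inside  ∷ q} p⊆q eq =
  ⊥-elim (<-irrefl eq (s≤s (p⊆q⇒∣p∣≤∣q∣ (drop-∷-⊆ p⊆q))))
⊆∧∣p∣≡∣q∣⇒p≡q {p = outside ∷ p} {outside ∷ q} p⊆q eq =
  cong (outside ∷_) (⊆∧∣p∣≡∣q∣⇒p≡q (drop-∷-⊆ p⊆q) eq)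

∈⇒1≤∣p∣ : {i : Fin n} {p : Subset n} → i ∈ₛ p → 1 ≤ ∣ p ∣
∈⇒1≤∣p∣ here                       = s≤s z≤n
∈⇒1≤∣p∣ {p = s ∷ p} (there i∈p) = ≤-trans (∈⇒1≤∣p∣ i∈p) (∣p∣≤∣x∷p∣ s p)

1≤∣p∣⇒Nonempty : (p : Subset n) → 1 ≤ ∣ p ∣ → Nonempty p
1≤∣p∣⇒Nonempty (inside  ∷ p) _  = zero , here
1≤∣p∣⇒Nonempty (outside ∷ p) 1≤∣p∣ with 1≤∣p∣⇒Nonempty p 1≤∣p∣
... | i , i∈p = suc i , there i∈p

2≤∣p∣⇒distinct₂ : (p : Subset n) → 2 ≤ ∣ p ∣ →
                  ∃₂ λ i j → i ≢ j × i ∈ₛ p × j ∈ₛ p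
2≤∣p∣⇒distinct₂ (inside  ∷ p) (s≤s 1≤∣p∣) with 1≤∣p∣⇒Nonempty p 1≤∣p∣
... | j , j∈p = zero , suc j , (λ ()) , here , there j∈p
2≤∣p∣⇒distinct₂ (outside ∷ p) 2≤∣p∣ with 2≤∣p∣⇒distinct₂ p 2≤∣p∣
... | i , j , i≢j , i∈p , j∈p = suc i , suc j , i≢j ∘ Finₚ.suc-injective , there i∈p , there j∈p

3≤∣p∣⇒distinct₃ : (p : Subset n) → 3 ≤ ∣ p ∣ →
                  ∃₂ λ i j → ∃ λ k → i ≢ j × i ≢ k × j ≢ k × i ∈ₛ p × j ∈ₛ p × k ∈ₛ p
3≤∣p∣⇒distinct₃ (inside  ∷ p) (s≤s 2≤∣p∣) with 2≤∣p∣⇒distinct₂ p 2≤∣p∣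
... | j , k , j≢k , j∈p , k∈p =
  zero , suc j , suc k , (λ ()) , (λ ()) , j≢k ∘ Finₚ.suc-injective , here , there j∈p , there k∈p
3≤∣p∣⇒distinct₃ (outside ∷ p) 3≤∣p∣ with 3≤∣p∣⇒distinct₃ p 3≤∣p∣
... | i , j , k , i≢j , i≢k , j≢k , i∈p , j∈p , k∈p =
  suc i , suc j , suc k , i≢j ∘ Finₚ.suc-injective , i≢k ∘ Finₚ.suc-injective , j≢k ∘ Finₚ.suc-injective ,
  there i∈p , there j∈p , there k∈p

Empty⁅i⁆∩⁅j⁆ : {i j : Fin n} → i ≢ j → Empty (⁅ i ⁆ ∩ ⁅ j ⁆)
Empty⁅i⁆∩⁅j⁆ {i = i} {j} i≢j (k , k∈⁅i⁆∩⁅j⁆) with x∈p∩q⁻ ⁅ i ⁆ ⁅ j ⁆ k∈⁅i⁆∩⁅j⁆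
... | k∈⁅i⁆ , k∈⁅j⁆ = i≢j (trans (sym (x∈⁅y⁆⇒x≡y i k∈⁅i⁆)) (x∈⁅y⁆⇒x≡y j k∈⁅j⁆))

≢⇒∉⁅i⁆∪⁅j⁆ : {i j k : Fin n} → k ≢ i → k ≢ j → k ∉ₛ ⁅ i ⁆ ∪ ⁅ j ⁆
≢⇒∉⁅i⁆∪⁅j⁆ {i = i} {j} k≢i k≢j k∈pair with x∈p∪q⁻ ⁅ i ⁆ ⁅ j ⁆ k∈pair
... | inj₁ k∈⁅i⁆ = k≢i (x∈⁅y⁆⇒x≡y i k∈⁅i⁆)
... | inj₂ k∈⁅j⁆ = k≢j (x∈⁅y⁆⇒x≡y j k∈⁅j⁆)

∉⁅i⁆∪⁅j⁆⇒≢ : {i j k : Fin n} → k ∉ₛ ⁅ i ⁆ ∪ ⁅ j ⁆ → k ≢ i × k ≢ j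
∉⁅i⁆∪⁅j⁆⇒≢ {k = k} k∉ = (λ { refl → k∉ (x∈p∪q⁺ (inj₁ (x∈⁅x⁆ k))) }) ,
                        (λ { refl → k∉ (x∈p∪q⁺ (inj₂ (x∈⁅x⁆ k))) })

module _ {A : Set} {P : A → Set} where

  duo-covered : {x y a b : A} → x ∈ a ∷ b ∷ [] → y ∈ a ∷ b ∷ [] → x ≢ y → P x → P y → P a × P b
  duo-covered (here refl)         (here refl)         x≢y _  _  = ⊥-elim (x≢y refl)
  duo-covered (here refl)         (there (here refl)) _   px py = px , py
  duo-covered (there (here refl)) (here refl)         _   px py = py , px
  duo-covered (there (here refl)) (there (here refl)) x≢y _  _  = ⊥-elim (x≢y refl)

no-three-in-duo : {A : Set} {x y z a b : A} → x ∈ a ∷ b ∷ [] → y ∈ a ∷ b ∷ [] → z ∈ a ∷ b ∷ [] →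
                  x ≢ y → x ≢ z → y ≢ z → ⊥
no-three-in-duo {z = z} x∈ y∈ z∈ x≢y x≢z y≢z with duo-covered {P = _≢ z} x∈ y∈ x≢y x≢z y≢z
... | a≢z , b≢z with z∈
...   | here refl         = a≢z refl
...   | there (here refl) = b≢z refl

module _ {A : Set} {P : A → Set} where

  triple-covered : {x y z a m b : A} → x ∈ a ∷ m ∷ b ∷ [] → y ∈ a ∷ m ∷ b ∷ [] → z ∈ a ∷ m ∷ b ∷ [] →
                   x ≢ y → x ≢ z → y ≢ z → P x → P y → P z → P a × P m × P b
  triple-covered (here refl) y∈ z∈ x≢y x≢z y≢z px py pz =
    px , duo-covered (Any.tail (x≢y ∘ sym) y∈) (Any.tail (x≢z ∘ sym) z∈) y≢z py pz
  triple-covered (there x∈) (here refl) z∈ x≢y x≢z y≢z px py pz =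
    py , duo-covered x∈ (Any.tail (y≢z ∘ sym) z∈) x≢z px pz
  triple-covered (there x∈) (there y∈) (here refl) x≢y x≢z y≢z px py pz =
    pz , duo-covered x∈ y∈ x≢y px py
  triple-covered (there x∈) (there y∈) (there z∈) x≢y x≢z y≢z px py pz =
    ⊥-elim (no-three-in-duo x∈ y∈ z∈ x≢y x≢z y≢z)

  tail-covered : {x y u v w : A} → ¬ P u → x ∈ u ∷ v ∷ w ∷ [] → y ∈ u ∷ v ∷ w ∷ [] →
                 x ≢ y → P x → P y → P v × P w
  tail-covered ¬pu x∈ y∈ x≢y px py =
    duo-covered (Any.tail (λ x≡u → ¬pu (subst P x≡u px)) x∈) (Any.tail (λ y≡u → ¬pu (subst P y≡u py)) y∈)
                x≢y px py

∈-reverse₃ : {A : Set} {x a m b : A} → x ∈ a ∷ m ∷ b ∷ [] → x ∈ b ∷ m ∷ a ∷ []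
∈-reverse₃ (here refl)                 = there (there (here refl))
∈-reverse₃ (there (here refl))         = there (here refl)
∈-reverse₃ (there (there (here refl))) = here refl

_∈v_ : Fin n → KV n → Set
i ∈v v = i ∈ₛ proj₁ v

_∉v_ : Fin n → KV n → Set
i ∉v v = ¬ i ∈v v

KV-≡ : {u v : KV n} → proj₁ u ≡ proj₁ v → u ≡ v
KV-≡ {u = s , ∣s∣≡2} {t , ∣t∣≡2} refl = cong (s ,_) (≡-irrelevant ∣s∣≡2 ∣t∣≡2)

_≟v_ : DecidableEquality (KV n)
u ≟v v = Dec.map′ KV-≡ (cong proj₁) (≡-dec _≟ᵇ_ (proj₁ u) (proj₁ v))

pair : (i j : Fin n) → i ≢ j → KV n
pair i j i≢j = ⁅ i ⁆ ∪ ⁅ j ⁆ , (begin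
  ∣ ⁅ i ⁆ ∪ ⁅ j ⁆ ∣     ≡⟨ Empty[p∩q]⇒∣p∪q∣≡∣p∣+∣q∣ ⁅ i ⁆ ⁅ j ⁆ (Empty⁅i⁆∩⁅j⁆ i≢j) ⟩
  ∣ ⁅ i ⁆ ∣ + ∣ ⁅ j ⁆ ∣ ≡⟨ cong₂ _+_ (∣⁅x⁆∣≡1 i) (∣⁅x⁆∣≡1 j) ⟩
  2                     ∎)
  where open ≡-Reasoning

module _ {i j : Fin n} (i≢j : i ≢ j) where

  i∈pair : i ∈v pair i j i≢j
  i∈pair = x∈p∪q⁺ (inj₁ (x∈⁅x⁆ i))

  j∈pair : j ∈v pair i j i≢j
  j∈pair = x∈p∪q⁺ (inj₂ (x∈⁅x⁆ j))

  ∈pair⁻ : ∀ {k} → k ∈v pair i j i≢j → k ≡ i ⊎ k ≡ j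
  ∈pair⁻ k∈pair with x∈p∪q⁻ ⁅ i ⁆ ⁅ j ⁆ k∈pair
  ... | inj₁ k∈⁅i⁆ = inj₁ (x∈⁅y⁆⇒x≡y i k∈⁅i⁆)
  ... | inj₂ k∈⁅j⁆ = inj₂ (x∈⁅y⁆⇒x≡y j k∈⁅j⁆)

  pair-unique : {v : KV n} → i ∈v v → j ∈v v → pair i j i≢j ≡ v
  pair-unique {v} i∈v j∈v = KV-≡ (⊆∧∣p∣≡∣q∣⇒p≡q pair⊆v (trans (proj₂ (pair i j i≢j)) (sym (proj₂ v))))
    where
    pair⊆v : proj₁ (pair i j i≢j) ⊆ proj₁ v
    pair⊆v k∈pair with ∈pair⁻ k∈pair
    ... | inj₁ refl = i∈v
    ... | inj₂ refl = j∈v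

data PairView {n} : KV n → Set where
  pairOf : ∀ i j (i≢j : i ≢ j) → PairView (pair i j i≢j)

pairView : (v : KV n) → PairView v
pairView v with 2≤∣p∣⇒distinct₂ (proj₁ v) (≤-reflexive (sym (proj₂ v)))
... | i , j , i≢j , i∈v , j∈v = subst PairView (pair-unique i≢j i∈v j∈v) (pairOf i j i≢j)

data PairViewAt {n} (h : Fin n) : KV n → Set where
  pairWith : ∀ t (t≢h : t ≢ h) → PairViewAt h (pair t h t≢h)

pairViewAt : (v : KV n) {h : Fin n} → h ∈v v → PairViewAt h v
pairViewAt v h∈v with pairView v
... | pairOf i j i≢j with ∈pair⁻ i≢j h∈v
...   | inj₁ refl =
  subst (PairViewAt i) (pair-unique (i≢j ∘ sym) (j∈pair i≢j) (i∈pair i≢j)) (pairWith j (i≢j ∘ sym))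
...   | inj₂ refl = pairWith i i≢j

-- Adj u v only mentions proj₁ u ∩ proj₁ v, from which Agda cannot infer u and v, so the
-- development works with the record Meet and its negation, converting only at walks.
record Meet {n} (u v : KV n) : Set where
  constructor meetAt
  field
    point : Fin n
    ∈ₗ    : point ∈v u
    ∈ᵣ    : point ∈v v

meet-sym : {u v : KV n} → Meet u v → Meet v u
meet-sym (meetAt k k∈u k∈v) = meetAt k k∈v k∈u

Nonempty⇒Meet : {u v : KV n} → Nonempty (proj₁ u ∩ proj₁ v) → Meet u v
Nonempty⇒Meet {u = u} {v} (k , k∈u∩v) = let k∈u , k∈v = x∈p∩q⁻ (proj₁ u) (proj₁ v) k∈u∩v in meetAt k k∈u k∈v

Meet⇒Nonempty : {u v : KV n} → Meet u v → Nonempty (proj₁ u ∩ proj₁ v)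
Meet⇒Nonempty (meetAt k k∈u k∈v) = k , x∈p∩q⁺ (k∈u , k∈v)

adj⇒¬meet : {u v : KV n} → Adj u v → ¬ Meet u v
adj⇒¬meet adj = adj ∘ Meet⇒Nonempty

¬meet⇒adj : {u v : KV n} → ¬ Meet u v → Adj u v
¬meet⇒adj ¬meet = ¬meet ∘ Nonempty⇒Meet

meet? : (u v : KV n) → Dec (Meet u v)
meet? u v = Dec.map′ Nonempty⇒Meet Meet⇒Nonempty (nonempty? (proj₁ u ∩ proj₁ v))

meet-refl : (v : KV n) → Meet v v
meet-refl v with pairView v
... | pairOf i j i≢j = meetAt i (i∈pair i≢j) (i∈pair i≢j)

¬meet⇒≢ : {u v : KV n} → ¬ Meet u v → u ≢ v
¬meet⇒≢ {u = u} ¬meet refl = ¬meet (meet-refl u)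

pair-disjoint : {i j : Fin n} (i≢j : i ≢ j) {v : KV n} → i ∉v v → j ∉v v → ¬ Meet (pair i j i≢j) v
pair-disjoint i≢j i∉v j∉v (meetAt k k∈pair k∈v) with ∈pair⁻ i≢j k∈pair
... | inj₁ refl = i∉v k∈v
... | inj₂ refl = j∉v k∈v

meet-pair-outside : {s : KV n} {t h : Fin n} (t≢h : t ≢ h) → Meet s (pair t h t≢h) → h ∉v s → t ∈v s
meet-pair-outside t≢h (meetAt k k∈s k∈pair) h∉s with ∈pair⁻ t≢h k∈pair
... | inj₁ refl = k∈s
... | inj₂ refl = ⊥-elim (h∉s k∈s)

meet⇒∣u∪v∣≤3 : {u v : KV n} → Meet u v → ∣ proj₁ u ∪ proj₁ v ∣ ≤ 3
meet⇒∣u∪v∣≤3 {u = u} {v} (meetAt k k∈u k∈v) = +-cancelʳ-≤ 1 ∣ u∪v ∣ 3 (begin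
  ∣ u∪v ∣ + 1                        ≤⟨ +-monoʳ-≤ ∣ u∪v ∣ (∈⇒1≤∣p∣ (x∈p∩q⁺ (k∈u , k∈v))) ⟩
  ∣ u∪v ∣ + ∣ proj₁ u ∩ proj₁ v ∣    ≡⟨ ∣p∪q∣+∣p∩q∣≡∣p∣+∣q∣ (proj₁ u) (proj₁ v) ⟩
  ∣ proj₁ u ∣ + ∣ proj₁ v ∣          ≡⟨ cong₂ _+_ (proj₂ u) (proj₂ v) ⟩
  4                                  ∎)
  where
  open ≤-Reasoning
  u∪v = proj₁ u ∪ proj₁ v

-- Shortest paths for n ≥ 5

common-neighbour : 5 ≤ n → {u v : KV n} → Meet u v → ∃ λ m → ¬ Meet u m × ¬ Meet m v
common-neighbour {n} 5≤n {u} {v} u∩v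
  with 2≤∣p∣⇒distinct₂ (∁ (proj₁ u ∪ proj₁ v))
         (≤-trans (∸-mono 5≤n (meet⇒∣u∪v∣≤3 u∩v)) (≤-reflexive (sym (∣∁p∣≡n∸∣p∣ (proj₁ u ∪ proj₁ v)))))
... | i , j , i≢j , i∉u∪v , j∉u∪v =
  pair i j i≢j , pair-disjoint i≢j (∉u i∉u∪v) (∉u j∉u∪v) ∘ meet-sym , pair-disjoint i≢j (∉v i∉u∪v) (∉v j∉u∪v)
  where
  ∉u : ∀ {l} → l ∈ₛ ∁ (proj₁ u ∪ proj₁ v) → l ∉v u
  ∉u l∉u∪v l∈u = x∈∁p⇒x∉p l∉u∪v (x∈p∪q⁺ (inj₁ l∈u))
  ∉v : ∀ {l} → l ∈ₛ ∁ (proj₁ u ∪ proj₁ v) → l ∉v v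
  ∉v l∉u∪v l∈v = x∈∁p⇒x∉p l∉u∪v (x∈p∪q⁺ (inj₂ l∈v))

record Geodesic {n} (u m w : KV n) : Set where
  constructor geodesic
  field
    u#m : ¬ Meet u m
    m#w : ¬ Meet m w
    u∩w : Meet u w
    u≢w : u ≢ w

geodesic-sym : {u m w : KV n} → Geodesic u m w → Geodesic w m u
geodesic-sym (geodesic u#m m#w u∩w u≢w) = geodesic (m#w ∘ meet-sym) (u#m ∘ meet-sym) (meet-sym u∩w) (u≢w ∘ sym)

walk-len≥2 : {a b : KV n} → Meet a b → a ≢ b → (q : Walk a b) → 2 ≤ len q
walk-len≥2 a∩b a≢b [ _ ]            = ⊥-elim (a≢b refl)
walk-len≥2 a∩b a≢b (a~b ∷ [ _ ])    = ⊥-elim (adj⇒¬meet a~b a∩b)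
walk-len≥2 a∩b a≢b (_ ∷ _ ∷ _)      = s≤s (s≤s z≤n)

geodesic-walk : {u m w : KV n} → Geodesic u m w → Walk u w
geodesic-walk {m = m} {w} (geodesic u#m m#w _ _) = _∷_ {v = m} (¬meet⇒adj u#m) (¬meet⇒adj m#w ∷ [ w ])

geodesic-shortest : {u m w : KV n} (g : Geodesic u m w) → IsShortestPath (geodesic-walk g)
geodesic-shortest (geodesic u#m m#w u∩w u≢w) =
  ((¬meet⇒≢ u#m ∷ u≢w ∷ []) ∷ (¬meet⇒≢ m#w ∷ []) ∷ [] ∷ []) , walk-len≥2 u∩w u≢w

distance≤2 : 5 ≤ n → (a b : KV n) → ∃ λ (q : Walk a b) → len q ≤ 2
distance≤2 5≤n a b with a ≟v b | meet? a b
... | yes refl | _       = [ a ] , z≤n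
... | no _     | no a#b  = ¬meet⇒adj a#b ∷ [ b ] , s≤s z≤n
... | no a≢b   | yes a∩b with common-neighbour 5≤n a∩b
...   | _ , a#m , m#b = geodesic-walk (geodesic a#m m#b a∩b a≢b) , ≤-refl

data ShortestShape {n} : KV n → KV n → List (KV n) → Set where
  path₀ : ∀ {a}     → ShortestShape a a (a ∷ [])
  path₁ : ∀ {a b}   → ShortestShape a b (a ∷ b ∷ [])
  path₂ : ∀ {a m b} → Geodesic a m b → ShortestShape a b (a ∷ m ∷ b ∷ [])

shortest-shape : 5 ≤ n → {a b : KV n} (p : Walk a b) → IsShortestPath p → ShortestShape a b (verts p)
shortest-shape 5≤n [ a ]                   _             = path₀
shortest-shape 5≤n (_ ∷ [ b ])             _             = path₁
shortest-shape 5≤n {a} {b} (a~m ∷ m~b ∷ [ b ]) (_ , shortest) =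
  path₂ (geodesic (adj⇒¬meet a~m) (adj⇒¬meet m~b) a∩b a≢b)
  where
  a≢b : a ≢ b
  a≢b refl with shortest [ a ]
  ... | ()
  a∩b : Meet a b
  a∩b with meet? a b
  ... | yes a∩b = a∩b
  ... | no a#b with shortest (¬meet⇒adj a#b ∷ [ b ])
  ...   | s≤s ()
shortest-shape 5≤n {a} {b} (_ ∷ _ ∷ _ ∷ _) (_ , shortest) with distance≤2 5≤n a b
... | q , len≤2 with ≤-trans (shortest q) len≤2
...   | s≤s (s≤s ())

-- Terminal sets

GeodesicFree : List (KV n) → Set
GeodesicFree S = ∀ {u m w} → u ∈ S → m ∈ S → w ∈ S → ¬ Geodesic u m w

record Terminal {n} (S : List (KV n)) : Set where
  field
    unique          : Unique S
    geodesic-free   : GeodesicFree S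
    outer-geodesic  : ∀ {u} → u ∉ S → ∃₂ λ m w → m ∈ S × w ∈ S × Geodesic u m w

GenPos⇒GeodesicFree : {S : List (KV n)} → GenPos S → GeodesicFree S
GenPos⇒GeodesicFree genPos u∈S m∈S w∈S g@(geodesic u#m m#w _ u≢w) =
  genPos (geodesic-walk g) (geodesic-shortest g) _ _ _ u∈S m∈S w∈S (¬meet⇒≢ u#m) (¬meet⇒≢ m#w) u≢w
         (here refl) (there (here refl)) (there (there (here refl)))

GeodesicFree⇒GenPos : 5 ≤ n → {S : List (KV n)} → GeodesicFree S → GenPos S
GeodesicFree⇒GenPos 5≤n {S} free p shortest x y z x∈S y∈S z∈S x≢y y≢z x≢z x∈p y∈p z∈p
  with verts p | shortest-shape 5≤n p shortest
... | _ | path₀ with x∈p | y∈p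
...   | here refl | here refl = x≢y refl
GeodesicFree⇒GenPos 5≤n free p shortest x y z x∈S y∈S z∈S x≢y y≢z x≢z x∈p y∈p z∈p
    | _ | path₁ = no-three-in-duo x∈p y∈p z∈p x≢y x≢z y≢z
GeodesicFree⇒GenPos 5≤n {S} free p shortest x y z x∈S y∈S z∈S x≢y y≢z x≢z x∈p y∈p z∈p
    | _ | path₂ g with triple-covered {P = _∈ S} x∈p y∈p z∈p x≢y x≢z y≢z x∈S y∈S z∈S
...   | a∈S , m∈S , b∈S = free a∈S m∈S b∈S g

outsider-geodesic : 5 ≤ n → {S : List (KV n)} {a b u x y : KV n} (p : Walk a b) → IsShortestPath p →
                    u ≡ a ⊎ u ≡ b → u ∉ S → x ∈ S → y ∈ S → x ≢ y → x ∈ verts p → y ∈ verts p →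
                    ∃₂ λ m w → m ∈ S × w ∈ S × Geodesic u m w
outsider-geodesic 5≤n p shortest u-end u∉S x∈S y∈S x≢y x∈p y∈p with verts p | shortest-shape 5≤n p shortest
... | _ | path₀ with x∈p | y∈p
...   | here refl | here refl = ⊥-elim (x≢y refl)
outsider-geodesic 5≤n {S} p shortest u-end u∉S x∈S y∈S x≢y x∈p y∈p | _ | path₁
  with duo-covered {P = _∈ S} x∈p y∈p x≢y x∈S y∈S | u-end
... | a∈S , _ | inj₁ refl = ⊥-elim (u∉S a∈S)
... | _ , b∈S | inj₂ refl = ⊥-elim (u∉S b∈S)
outsider-geodesic 5≤n {a = a} {b} p shortest u-end u∉S x∈S y∈S x≢y x∈p y∈p | _ | path₂ {m = m} g
  with u-end
... | inj₁ refl = let m∈S , b∈S = tail-covered u∉S x∈p y∈p x≢y x∈S y∈S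
                  in m , b , m∈S , b∈S , g
... | inj₂ refl = let m∈S , a∈S = tail-covered u∉S (∈-reverse₃ x∈p) (∈-reverse₃ y∈p) x≢y x∈S y∈S
                  in m , a , m∈S , a∈S , geodesic-sym g

IsTerminal⇒Terminal : 5 ≤ n → {S : List (KV n)} → IsTerminal S → Terminal S
IsTerminal⇒Terminal 5≤n {S} (unique , genPos , _ , outer) = record
  { unique         = unique
  ; geodesic-free  = GenPos⇒GeodesicFree genPos
  ; outer-geodesic = outer-geodesic
  }
  where
  outer-geodesic : ∀ {u} → u ∉ S → ∃₂ λ m w → m ∈ S × w ∈ S × Geodesic u m w
  outer-geodesic {u} u∉S with outer u u∉S
  ... | _ , _ , p , shortest , u-end , _ , _ , x∈S , y∈S , x≢y , x∈p , y∈p =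
    outsider-geodesic 5≤n p shortest u-end u∉S x∈S y∈S x≢y x∈p y∈p

Terminal⇒IsTerminal : 5 ≤ n → {S : List (KV n)} → Terminal S → IsTerminal S
Terminal⇒IsTerminal {n} 5≤n {S} T = unique , GeodesicFree⇒GenPos 5≤n geodesic-free , maximal , outer
  where
  open Terminal T
  maximal : ∀ u → u ∉ S → ¬ GenPos (u ∷ S)
  maximal u u∉S genPos with outer-geodesic u∉S
  ... | m , w , m∈S , w∈S , g = GenPos⇒GeodesicFree genPos (here refl) (there m∈S) (there w∈S) g
  outer : ∀ u → u ∉ S →
          Σ (KV n) λ a → Σ (KV n) λ b → Σ (Walk a b) λ p →
            IsShortestPath p × (u ≡ a ⊎ u ≡ b) ×
            Σ (KV n) λ x → Σ (KV n) λ y → x ∈ S × y ∈ S × x ≢ y × x ∈ verts p × y ∈ verts p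
  outer u u∉S with outer-geodesic u∉S
  ... | m , w , m∈S , w∈S , g@(geodesic _ m#w _ _) =
    u , w , geodesic-walk g , geodesic-shortest g , inj₁ refl , m , w , m∈S , w∈S , ¬meet⇒≢ m#w ,
    there (here refl) , there (there (here refl))

module _ {S : List (KV n)} (T : Terminal S) where
  open Terminal T

  disjoint-transfers-meet : {x y s : KV n} → x ∈ S → y ∈ S → s ∈ S →
                            ¬ Meet x y → s ≢ x → Meet s x → Meet s y
  disjoint-transfers-meet {x} {y} {s} x∈S y∈S s∈S x#y s≢x s∩x with meet? s y
  ... | yes s∩y = s∩y
  ... | no s#y  = ⊥-elim (geodesic-free s∈S y∈S x∈S (geodesic s#y (x#y ∘ meet-sym) s∩x s≢x))

  meets-either : {x z w : KV n} → x ∈ S → z ∈ S → x ≢ z → Meet x z → w ∈ S → Meet w x ⊎ Meet w z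
  meets-either {x} {z} {w} x∈S z∈S x≢z x∩z w∈S with meet? w x | meet? w z
  ... | yes w∩x | _       = inj₁ w∩x
  ... | no _    | yes w∩z = inj₂ w∩z
  ... | no w#x  | no w#z  = ⊥-elim (geodesic-free x∈S w∈S z∈S (geodesic (w#x ∘ meet-sym) w#z x∩z x≢z))

-- Covered points and matchings

Covered : List (KV n) → Fin n → Set
Covered S i = ∃ λ w → w ∈ S × i ∈v w

CoversAllButOne : List (KV n) → Set
CoversAllButOne S = ∀ {i j} → i ≢ j → Covered S i ⊎ Covered S j

terminal-covers : {S : List (KV n)} → Terminal S → CoversAllButOne S
terminal-covers {S = S} T {i} {j} i≢j with Membership._∈?_ _≟v_ (pair i j i≢j) S
... | yes u∈S = inj₁ (pair i j i≢j , u∈S , i∈pair i≢j)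
... | no u∉S with Terminal.outer-geodesic T u∉S
...   | _ , w , _ , w∈S , geodesic _ _ (meetAt k k∈u k∈w) _ with ∈pair⁻ i≢j k∈u
...     | inj₁ refl = inj₁ (w , w∈S , k∈w)
...     | inj₂ refl = inj₂ (w , w∈S , k∈w)

points : List (KV n) → Subset n
points S = Subset.⋃ (map proj₁ S)

∈points⁺ : {S : List (KV n)} {i : Fin n} → Covered S i → i ∈ₛ points S
∈points⁺ (w , here refl , i∈w) = x∈p∪q⁺ (inj₁ i∈w)
∈points⁺ (w , there w∈S , i∈w) = x∈p∪q⁺ (inj₂ (∈points⁺ (w , w∈S , i∈w)))

∈points⁻ : (S : List (KV n)) {i : Fin n} → i ∈ₛ points S → Covered S i
∈points⁻ []      i∈ = ⊥-elim (∉⊥ i∈)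
∈points⁻ (v ∷ S) i∈ with x∈p∪q⁻ (proj₁ v) (points S) i∈
... | inj₁ i∈v = v , here refl , i∈v
... | inj₂ i∈S with ∈points⁻ S i∈S
...   | w , w∈S , i∈w = w , there w∈S , i∈w

IsMatching : List (KV n) → Set
IsMatching = AllPairs (λ u v → ¬ Meet u v)

∣points∣≡length*2 : {S : List (KV n)} → IsMatching S → ∣ points S ∣ ≡ length S * 2
∣points∣≡length*2 {n} {S = []} []                = ∣⊥∣≡0 n
∣points∣≡length*2 {S = v ∷ S} (v#S ∷ matching) =
  trans (Empty[p∩q]⇒∣p∪q∣≡∣p∣+∣q∣ (proj₁ v) (points S) disjoint)
        (cong₂ _+_ (proj₂ v) (∣points∣≡length*2 matching))
  where
  disjoint : Empty (proj₁ v ∩ points S)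
  disjoint (i , i∈v∩S) with x∈p∩q⁻ (proj₁ v) (points S) i∈v∩S
  ... | i∈v , i∈S with ∈points⁻ S i∈S
  ...   | w , w∈S , i∈w = All.lookup v#S w∈S (meetAt i i∈v i∈w)

m*2≤n<[1+m]*2⇒n/2≡m : ∀ {m n} → m * 2 ≤ n → n < suc m * 2 → n / 2 ≡ m
m*2≤n<[1+m]*2⇒n/2≡m {m} {n} lower upper = ≤-antisym (≤-pred (m<n*o⇒m/o<n upper)) (begin
  m         ≡⟨ m*n/n≡m m 2 ⟨
  m * 2 / 2 ≤⟨ /-monoˡ-≤ 2 lower ⟩
  n / 2     ∎)
  where open ≤-Reasoning

matching-length : {S : List (KV n)} → IsMatching S → CoversAllButOne S → length S ≡ n / 2
matching-length {n} {S} matching covers = sym (m*2≤n<[1+m]*2⇒n/2≡m lower (s≤s upper))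
  where
  P : Subset n
  P = points S
  ∣P∣≡ : ∣ P ∣ ≡ length S * 2
  ∣P∣≡ = ∣points∣≡length*2 matching
  lower : length S * 2 ≤ n
  lower = subst (_≤ n) ∣P∣≡ (∣p∣≤n P)
  ∣∁P∣≤1 : ∣ ∁ P ∣ ≤ 1
  ∣∁P∣≤1 with ∣ ∁ P ∣ ≤? 1
  ... | yes ≤1 = ≤1
  ... | no ≰1 with 2≤∣p∣⇒distinct₂ (∁ P) (≰⇒> ≰1)
  ...   | i , j , i≢j , i∈∁P , j∈∁P with covers i≢j
  ...     | inj₁ covered = ⊥-elim (x∈∁p⇒x∉p i∈∁P (∈points⁺ covered))
  ...     | inj₂ covered = ⊥-elim (x∈∁p⇒x∉p j∈∁P (∈points⁺ covered))
  upper : n ≤ suc (length S * 2)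
  upper = begin
    n                      ≡⟨ m∸n+n≡m (∣p∣≤n P) ⟨
    (n ∸ ∣ P ∣) + ∣ P ∣    ≡⟨ cong (_+ ∣ P ∣) (∣∁p∣≡n∸∣p∣ P) ⟨
    ∣ ∁ P ∣ + ∣ P ∣        ≡⟨ cong (∣ ∁ P ∣ +_) ∣P∣≡ ⟩
    ∣ ∁ P ∣ + length S * 2 ≤⟨ +-monoˡ-≤ (length S * 2) ∣∁P∣≤1 ⟩
    suc (length S * 2)     ∎
    where open ≤-Reasoning

matching-meet⇒≡ : {S : List (KV n)} {u w : KV n} → IsMatching S → u ∈ S → w ∈ S → Meet u w → u ≡ w
matching-meet⇒≡ (u#S ∷ _)        (here refl) (here refl) _   = refl
matching-meet⇒≡ (u#S ∷ _)        (here refl) (there w∈S) u∩w = ⊥-elim (All.lookup u#S w∈S u∩w)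
matching-meet⇒≡ (w#S ∷ _)        (there u∈S) (here refl) u∩w = ⊥-elim (All.lookup w#S u∈S (meet-sym u∩w))
matching-meet⇒≡ (_ ∷ matching)   (there u∈S) (there w∈S) u∩w = matching-meet⇒≡ matching u∈S w∈S u∩w

covering-meets : {S : List (KV n)} → CoversAllButOne S → (u : KV n) → ∃ λ w → w ∈ S × Meet u w
covering-meets covers u with pairView u
... | pairOf i j i≢j with covers i≢j
...   | inj₁ (w , w∈S , i∈w) = w , w∈S , meetAt i (i∈pair i≢j) i∈w
...   | inj₂ (w , w∈S , j∈w) = w , w∈S , meetAt j (j∈pair i≢j) j∈w

disjoint-from-one-of-three : {e₁ e₂ e₃ : KV n} → ¬ Meet e₁ e₂ → ¬ Meet e₁ e₃ → ¬ Meet e₂ e₃ →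
                             (u : KV n) → ∃ λ m → m ∈ e₁ ∷ e₂ ∷ e₃ ∷ [] × ¬ Meet u m
disjoint-from-one-of-three {e₁ = e₁} {e₂} {e₃} e₁#e₂ e₁#e₃ e₂#e₃ u with meet? u e₁ | meet? u e₂ | meet? u e₃
... | no u#e₁ | _       | _       = e₁ , here refl , u#e₁
... | yes _   | no u#e₂ | _       = e₂ , there (here refl) , u#e₂
... | yes _   | yes _   | no u#e₃ = e₃ , there (there (here refl)) , u#e₃
... | yes (meetAt k₁ k₁∈u k₁∈e₁) | yes (meetAt k₂ k₂∈u k₂∈e₂) | yes (meetAt k₃ k₃∈u k₃∈e₃) with pairView u
...   | pairOf i j i≢j = ⊥-elim (no-three-in-duo (∈duo k₁∈u) (∈duo k₂∈u) (∈duo k₃∈u)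
                                  (λ { refl → e₁#e₂ (meetAt k₁ k₁∈e₁ k₂∈e₂) })
                                  (λ { refl → e₁#e₃ (meetAt k₁ k₁∈e₁ k₃∈e₃) })
                                  (λ { refl → e₂#e₃ (meetAt k₂ k₂∈e₂ k₃∈e₃) }))
  where
  ∈duo : ∀ {k} → k ∈v pair i j i≢j → k ∈ i ∷ j ∷ []
  ∈duo k∈u with ∈pair⁻ i≢j k∈u
  ... | inj₁ refl = here refl
  ... | inj₂ refl = there (here refl)

matching-terminal : {S : List (KV n)} → IsMatching S → CoversAllButOne S → 3 ≤ length S → Terminal S
matching-terminal {S = []}         _ _ ()
matching-terminal {S = _ ∷ []}     _ _ (s≤s ())
matching-terminal {S = _ ∷ _ ∷ []} _ _ (s≤s (s≤s ()))
matching-terminal {n} {S = e₁ ∷ e₂ ∷ e₃ ∷ rest} matching@((e₁#e₂ ∷ e₁#e₃ ∷ _) ∷ (e₂#e₃ ∷ _) ∷ _) covers _ = record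
  { unique         = AllPairs.map ¬meet⇒≢ matching
  ; geodesic-free  = λ u∈S _ w∈S (geodesic _ _ u∩w u≢w) → u≢w (matching-meet⇒≡ matching u∈S w∈S u∩w)
  ; outer-geodesic = outer-geodesic
  }
  where
  S : List (KV n)
  S = e₁ ∷ e₂ ∷ e₃ ∷ rest
  outer-geodesic : ∀ {u} → u ∉ S → ∃₂ λ m w → m ∈ S × w ∈ S × Geodesic u m w
  outer-geodesic {u} u∉S with covering-meets covers u | disjoint-from-one-of-three e₁#e₂ e₁#e₃ e₂#e₃ u
  ... | w , w∈S , u∩w | m , m∈e , u#m = m , w , m∈S , w∈S , geodesic u#m m#w u∩w u≢w
    where
    m∈S : m ∈ S
    m∈S = ∈-++⁺ˡ m∈e
    m#w : ¬ Meet m w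
    m#w m∩w = u#m (subst (Meet u) (sym (matching-meet⇒≡ matching m∈S w∈S m∩w)) u∩w)
    u≢w : u ≢ w
    u≢w refl = u∉S w∈S

unique-pairwise-matching : {S : List (KV n)} → Unique S →
                           (∀ {x z} → x ∈ S → z ∈ S → x ≢ z → ¬ Meet x z) → IsMatching S
unique-pairwise-matching []               _        = []
unique-pairwise-matching (x≢S ∷ unique) pairwise =
  All.tabulate (λ z∈S → pairwise (here refl) (there z∈S) (All.lookup x≢S z∈S)) ∷
  unique-pairwise-matching unique (λ x∈S z∈S → pairwise (there x∈S) (there z∈S))

HasMeetingPair : List (KV n) → Set
HasMeetingPair S = ∃₂ λ x z → x ∈ S × z ∈ S × x ≢ z × Meet x z

matching⊎meeting-pair : {S : List (KV n)} → Unique S → IsMatching S ⊎ HasMeetingPair S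
matching⊎meeting-pair {S = []}    []             = inj₁ []
matching⊎meeting-pair {S = x ∷ S} (x≢S ∷ unique) with All.all? (λ z → ¬? (meet? x z)) S
... | no ¬x#S with find (Allₚ.¬All⇒Any¬ (λ z → ¬? (meet? x z)) S ¬x#S)
...   | z , z∈S , ¬x#z =
  inj₂ (x , z , here refl , there z∈S , All.lookup x≢S z∈S , decidable-stable (meet? x z) ¬x#z)
matching⊎meeting-pair {S = x ∷ S} (x≢S ∷ unique) | yes x#S with matching⊎meeting-pair unique
... | inj₁ matching                          = inj₁ (x#S ∷ matching)
... | inj₂ (y , z , y∈S , z∈S , y≢z , y∩z) = inj₂ (y , z , there y∈S , there z∈S , y≢z , y∩z)

matching-of-two-not-terminal : {S : List (KV n)} → IsMatching S → length S ≡ 2 → ¬ Terminal S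
matching-of-two-not-terminal {S = []}              _ ()
matching-of-two-not-terminal {S = _ ∷ []}          _ ()
matching-of-two-not-terminal {S = _ ∷ _ ∷ _ ∷ _}   _ ()
matching-of-two-not-terminal {S = y₁ ∷ y₂ ∷ []} ((y₁#y₂ ∷ []) ∷ _) _ T with pairView y₁ | pairView y₂
... | pairOf p p′ p≢p′ | pairOf q q′ q≢q′ = no-outer-geodesic
  where
  p≢q : p ≢ q
  p≢q refl = y₁#y₂ (meetAt p (i∈pair p≢p′) (i∈pair q≢q′))
  u∉S : pair p q p≢q ∉ pair p p′ p≢p′ ∷ pair q q′ q≢q′ ∷ []
  u∉S (here u≡y₁)         = y₁#y₂ (meetAt q (subst (q ∈v_) u≡y₁ (j∈pair p≢q)) (i∈pair q≢q′))
  u∉S (there (here u≡y₂)) = y₁#y₂ (meetAt p (i∈pair p≢p′) (subst (p ∈v_) u≡y₂ (i∈pair p≢q)))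
  no-outer-geodesic : ⊥
  no-outer-geodesic with Terminal.outer-geodesic T u∉S
  ... | _ , _ , here refl         , _ , geodesic u#m _ _ _ = u#m (meetAt p (i∈pair p≢q) (i∈pair p≢p′))
  ... | _ , _ , there (here refl) , _ , geodesic u#m _ _ _ = u#m (meetAt q (j∈pair p≢q) (i∈pair q≢q′))

-- Terminal sets containing two meeting vertices

-- Every member of S through a point outside {a,b,c}
-- has its other point in {a,b,c} (anchor); two such members through distinct outside points
-- are both anchored at a, so the vertex on two covered outside points has no geodesic into S.
module OutsideCover {S : List (KV n)} (T : Terminal S) {a b c : Fin n} (b≢a : b ≢ a) (c≢a : c ≢ a)
                   (b≢c : b ≢ c) (x∈S : pair b a b≢a ∈ S) (z∈S : pair c a c≢a ∈ S) where
  open Terminal T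

  private
    x z : KV n
    x = pair b a b≢a
    z = pair c a c≢a

    Outside : Fin n → Set
    Outside h = h ∉ₛ proj₁ x ∪ proj₁ z

    ∉x : ∀ {h} → Outside h → h ∉v x
    ∉x out h∈x = out (x∈p∪q⁺ (inj₁ h∈x))

    ∉z : ∀ {h} → Outside h → h ∉v z
    ∉z out h∈z = out (x∈p∪q⁺ (inj₂ h∈z))

    b∉z : b ∉v z
    b∉z = ≢⇒∉⁅i⁆∪⁅j⁆ b≢c b≢a

    c∉x : c ∉v x
    c∉x = ≢⇒∉⁅i⁆∪⁅j⁆ (b≢c ∘ sym) c≢a

    x≢z : x ≢ z
    x≢z x≡z = b∉z (subst (b ∈v_) x≡z (i∈pair b≢a))

    x∩z : Meet x z
    x∩z = meetAt a (j∈pair b≢a) (j∈pair c≢a)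

    InT : Fin n → Set
    InT t = t ≡ a ⊎ t ≡ b ⊎ t ≡ c

    anchor : ∀ {t h} (t≢h : t ≢ h) → pair t h t≢h ∈ S → Outside h → InT t
    anchor t≢h y∈S out with meets-either T x∈S z∈S x≢z x∩z y∈S
    ... | inj₁ y∩x with ∈pair⁻ b≢a (meet-pair-outside t≢h (meet-sym y∩x) (∉x out))
    ...   | inj₁ refl = inj₂ (inj₁ refl)
    ...   | inj₂ refl = inj₁ refl
    anchor t≢h y∈S out | inj₂ y∩z with ∈pair⁻ c≢a (meet-pair-outside t≢h (meet-sym y∩z) (∉z out))
    ...   | inj₁ refl = inj₂ (inj₂ refl)
    ...   | inj₂ refl = inj₁ refl

    Separates : KV n → Fin n → Fin n → Set
    Separates s t₁ t₂ = s ∈ S × (∀ {h} → Outside h → h ∉v s) × t₁ ∈v s × t₂ ∉v s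

    separates : ∀ {t₁ t₂} → t₁ ≢ t₂ → InT t₁ → InT t₂ →
                ∃ λ s → Separates s t₁ t₂ ⊎ Separates s t₂ t₁
    separates t₁≢t₂ (inj₁ refl)        (inj₁ refl)        = ⊥-elim (t₁≢t₂ refl)
    separates t₁≢t₂ (inj₁ refl)        (inj₂ (inj₁ refl)) = z , inj₁ (z∈S , ∉z , j∈pair c≢a , b∉z)
    separates t₁≢t₂ (inj₁ refl)        (inj₂ (inj₂ refl)) = x , inj₁ (x∈S , ∉x , j∈pair b≢a , c∉x)
    separates t₁≢t₂ (inj₂ (inj₁ refl)) (inj₁ refl)        = z , inj₂ (z∈S , ∉z , j∈pair c≢a , b∉z)
    separates t₁≢t₂ (inj₂ (inj₁ refl)) (inj₂ (inj₁ refl)) = ⊥-elim (t₁≢t₂ refl)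
    separates t₁≢t₂ (inj₂ (inj₁ refl)) (inj₂ (inj₂ refl)) = x , inj₁ (x∈S , ∉x , i∈pair b≢a , c∉x)
    separates t₁≢t₂ (inj₂ (inj₂ refl)) (inj₁ refl)        = x , inj₂ (x∈S , ∉x , j∈pair b≢a , c∉x)
    separates t₁≢t₂ (inj₂ (inj₂ refl)) (inj₂ (inj₁ refl)) = z , inj₁ (z∈S , ∉z , i∈pair c≢a , b∉z)
    separates t₁≢t₂ (inj₂ (inj₂ refl)) (inj₂ (inj₂ refl)) = ⊥-elim (t₁≢t₂ refl)

    outside⇒¬InT : ∀ {h} → Outside h → ¬ InT h
    outside⇒¬InT out (inj₁ refl)        = ∉x out (j∈pair b≢a)
    outside⇒¬InT out (inj₂ (inj₁ refl)) = ∉x out (i∈pair b≢a)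
    outside⇒¬InT out (inj₂ (inj₂ refl)) = ∉z out (i∈pair c≢a)

    unseparated : ∀ {t₁ h₁ t₂ h₂ s} (t₁≢h₁ : t₁ ≢ h₁) (t₂≢h₂ : t₂ ≢ h₂) →
                  pair t₁ h₁ t₁≢h₁ ∈ S → pair t₂ h₂ t₂≢h₂ ∈ S → ¬ Meet (pair t₁ h₁ t₁≢h₁) (pair t₂ h₂ t₂≢h₂) →
                  Outside h₁ → Outside h₂ → ¬ Separates s t₁ t₂
    unseparated {t₁} {h₁} {t₂} {h₂} {s} t₁≢h₁ t₂≢h₂ y₁∈S y₂∈S y₁#y₂ out₁ out₂ (s∈S , out∉s , t₁∈s , t₂∉s) =
      t₂∉s (meet-pair-outside t₂≢h₂ s∩y₂ (out∉s out₂))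
      where
      s≢y₁ : s ≢ pair t₁ h₁ t₁≢h₁
      s≢y₁ refl = out∉s out₁ (j∈pair t₁≢h₁)
      s∩y₂ : Meet s (pair t₂ h₂ t₂≢h₂)
      s∩y₂ = disjoint-transfers-meet T y₁∈S y₂∈S s∈S y₁#y₂ s≢y₁ (meetAt t₁ t₁∈s (i∈pair t₁≢h₁))

    common-anchor : ∀ {t₁ h₁ t₂ h₂} (t₁≢h₁ : t₁ ≢ h₁) (t₂≢h₂ : t₂ ≢ h₂) →
                    pair t₁ h₁ t₁≢h₁ ∈ S → pair t₂ h₂ t₂≢h₂ ∈ S → h₁ ≢ h₂ → Outside h₁ → Outside h₂ → t₁ ≡ t₂
    common-anchor {t₁} {h₁} {t₂} {h₂} t₁≢h₁ t₂≢h₂ y₁∈S y₂∈S h₁≢h₂ out₁ out₂ with t₁ Finₚ.≟ t₂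
    ... | yes t₁≡t₂ = t₁≡t₂
    ... | no t₁≢t₂ = ⊥-elim separated-anchors
      where
      inT₁ : InT t₁
      inT₁ = anchor t₁≢h₁ y₁∈S out₁
      inT₂ : InT t₂
      inT₂ = anchor t₂≢h₂ y₂∈S out₂
      y₁#y₂ : ¬ Meet (pair t₁ h₁ t₁≢h₁) (pair t₂ h₂ t₂≢h₂)
      y₁#y₂ (meetAt k k∈y₁ k∈y₂) with ∈pair⁻ t₁≢h₁ k∈y₁ | ∈pair⁻ t₂≢h₂ k∈y₂
      ... | inj₁ refl | inj₁ refl = t₁≢t₂ refl
      ... | inj₁ refl | inj₂ refl = outside⇒¬InT out₂ inT₁
      ... | inj₂ refl | inj₁ refl = outside⇒¬InT out₁ inT₂
      ... | inj₂ refl | inj₂ refl = h₁≢h₂ refl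
      separated-anchors : ⊥
      separated-anchors with separates t₁≢t₂ inT₁ inT₂
      ... | _ , inj₁ sep = unseparated t₁≢h₁ t₂≢h₂ y₁∈S y₂∈S y₁#y₂ out₁ out₂ sep
      ... | _ , inj₂ sep = unseparated t₂≢h₂ t₁≢h₁ y₂∈S y₁∈S (y₁#y₂ ∘ meet-sym) out₂ out₁ sep

    ∈x∩z⇒≡a : ∀ {t} → t ∈v x → t ∈v z → t ≡ a
    ∈x∩z⇒≡a t∈x t∈z with ∈pair⁻ b≢a t∈x | ∈pair⁻ c≢a t∈z
    ... | inj₂ t≡a | _         = t≡a
    ... | _        | inj₂ t≡a  = t≡a
    ... | inj₁ refl | inj₁ refl = ⊥-elim (b≢c refl)

    shared-anchor-in : ∀ {t h₁ h₂ s} (t≢h₁ : t ≢ h₁) (t≢h₂ : t ≢ h₂) →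
                       pair t h₁ t≢h₁ ∈ S → pair t h₂ t≢h₂ ∈ S → h₁ ≢ h₂ → Outside h₁ → Outside h₂ →
                       s ∈ S → h₁ ∉v s → h₂ ∉v s → t ∈v s
    shared-anchor-in {t} {h₁} {h₂} t≢h₁ t≢h₂ y₁∈S y₂∈S h₁≢h₂ out₁ out₂ s∈S h₁∉s h₂∉s
      with meets-either T y₁∈S y₂∈S y₁≢y₂ (meetAt t (i∈pair t≢h₁) (i∈pair t≢h₂)) s∈S
      where
      y₁≢y₂ : pair t h₁ t≢h₁ ≢ pair t h₂ t≢h₂
      y₁≢y₂ y₁≡y₂ = ≢⇒∉⁅i⁆∪⁅j⁆ (t≢h₁ ∘ sym) h₁≢h₂ (subst (h₁ ∈v_) y₁≡y₂ (j∈pair t≢h₁))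
    ... | inj₁ s∩y₁ = meet-pair-outside t≢h₁ s∩y₁ h₁∉s
    ... | inj₂ s∩y₂ = meet-pair-outside t≢h₂ s∩y₂ h₂∉s

    anchored-at-a : ∀ {t₁ h₁ t₂ h₂} (t₁≢h₁ : t₁ ≢ h₁) (t₂≢h₂ : t₂ ≢ h₂) →
                    pair t₁ h₁ t₁≢h₁ ∈ S → pair t₂ h₂ t₂≢h₂ ∈ S → h₁ ≢ h₂ → Outside h₁ → Outside h₂ → t₁ ≡ a
    anchored-at-a t₁≢h₁ t₂≢h₂ y₁∈S y₂∈S h₁≢h₂ out₁ out₂
      with common-anchor t₁≢h₁ t₂≢h₂ y₁∈S y₂∈S h₁≢h₂ out₁ out₂
    ... | refl = ∈x∩z⇒≡a (shared-anchor-in t₁≢h₁ t₂≢h₂ y₁∈S y₂∈S h₁≢h₂ out₁ out₂ x∈S (∉x out₁) (∉x out₂))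
                         (shared-anchor-in t₁≢h₁ t₂≢h₂ y₁∈S y₂∈S h₁≢h₂ out₁ out₂ z∈S (∉z out₁) (∉z out₂))

  covered-outside-unique : ∀ {h₁ h₂} → h₁ ∉ₛ proj₁ x ∪ proj₁ z → h₂ ∉ₛ proj₁ x ∪ proj₁ z →
                           Covered S h₁ → Covered S h₂ → h₁ ≡ h₂
  covered-outside-unique {h₁} {h₂} out₁ out₂ (y₁ , y₁∈S , h₁∈y₁) (y₂ , y₂∈S , h₂∈y₂) with h₁ Finₚ.≟ h₂
  ... | yes h₁≡h₂ = h₁≡h₂
  ... | no h₁≢h₂ with pairViewAt y₁ h₁∈y₁ | pairViewAt y₂ h₂∈y₂
  ...   | pairWith t₁ t₁≢h₁ | pairWith t₂ t₂≢h₂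
    with anchored-at-a t₁≢h₁ t₂≢h₂ y₁∈S y₂∈S h₁≢h₂ out₁ out₂
       | anchored-at-a t₂≢h₂ t₁≢h₁ y₂∈S y₁∈S (h₁≢h₂ ∘ sym) out₂ out₁
  ...     | refl | refl = ⊥-elim no-outer-geodesic
    where
    u : KV n
    u = pair h₁ h₂ h₁≢h₂
    u∉S : u ∉ S
    u∉S u∈S = ∉x out₁ (subst (_∈v x) (sym (anchored-at-a h₁≢h₂ t₁≢h₁ u∈S y₁∈S (h₁≢h₂ ∘ sym) out₂ out₁))
                                     (j∈pair b≢a))
    a∈cover : ∀ {w k} → w ∈ S → k ∈v w → k ≡ h₁ ⊎ k ≡ h₂ → a ∈v w
    a∈cover {w} w∈S k∈w k≡h with pairViewAt w k∈w
    ... | pairWith t t≢k with k≡h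
    ...   | inj₁ refl = subst (_∈v w) (anchored-at-a t≢k t₂≢h₂ w∈S y₂∈S h₁≢h₂ out₁ out₂) (i∈pair t≢k)
    ...   | inj₂ refl = subst (_∈v w) (anchored-at-a t≢k t₁≢h₁ w∈S y₁∈S (h₁≢h₂ ∘ sym) out₂ out₁) (i∈pair t≢k)
    no-outer-geodesic : ⊥
    no-outer-geodesic with outer-geodesic u∉S
    ... | m , w , m∈S , w∈S , geodesic u#m m#w (meetAt k k∈u k∈w) _ =
      m#w (meetAt a a∈m (a∈cover w∈S k∈w (∈pair⁻ h₁≢h₂ k∈u)))
      where
      a∈m : a ∈v m
      a∈m = shared-anchor-in t₁≢h₁ t₂≢h₂ y₁∈S y₂∈S h₁≢h₂ out₁ out₂ m∈S
              (λ h₁∈m → u#m (meetAt h₁ (i∈pair h₁≢h₂) h₁∈m)) (λ h₂∈m → u#m (meetAt h₂ (j∈pair h₁≢h₂) h₂∈m))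

covered-outside-unique : {S : List (KV n)} → Terminal S → {x z : KV n} → x ∈ S → z ∈ S → x ≢ z → Meet x z →
                         ∀ {h₁ h₂} → h₁ ∉ₛ proj₁ x ∪ proj₁ z → h₂ ∉ₛ proj₁ x ∪ proj₁ z →
                         Covered S h₁ → Covered S h₂ → h₁ ≡ h₂
covered-outside-unique T {x} {z} x∈S z∈S x≢z (meetAt a a∈x a∈z) with pairViewAt x a∈x | pairViewAt z a∈z
... | pairWith b b≢a | pairWith c c≢a = OutsideCover.covered-outside-unique T b≢a c≢a b≢c x∈S z∈S
  where
  b≢c : b ≢ c
  b≢c refl = x≢z (KV-≡ refl)

covered-if-other-not : {S : List (KV n)} → CoversAllButOne S → ∀ {d e} → d ≢ e → ¬ Covered S d → Covered S e
covered-if-other-not covers d≢e d-uncovered with covers d≢e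
... | inj₁ d-covered = ⊥-elim (d-uncovered d-covered)
... | inj₂ e-covered = e-covered

module _ {S : List (KV n)} (covers : CoversAllButOne S) {P : Fin n → Set}
         (covered-unique : ∀ {h₁ h₂} → P h₁ → P h₂ → Covered S h₁ → Covered S h₂ → h₁ ≡ h₂) where

  one-of-two-uncovered : ∀ {d e} → d ≢ e → P d → P e → ¬ Covered S d ⊎ ¬ Covered S e
  one-of-two-uncovered d≢e pd pe with covers d≢e
  ... | inj₁ d-covered = inj₂ (d≢e ∘ covered-unique pd pe d-covered)
  ... | inj₂ e-covered = inj₁ (λ d-covered → d≢e (covered-unique pd pe d-covered e-covered))

  no-three : ∀ {d e f} → d ≢ e → d ≢ f → e ≢ f → P d → P e → P f → ⊥
  no-three d≢e d≢f e≢f pd pe pf with one-of-two-uncovered d≢e pd pe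
  ... | inj₁ d-uncovered =
    e≢f (covered-unique pe pf (covered-if-other-not covers d≢e d-uncovered)
                              (covered-if-other-not covers d≢f d-uncovered))
  ... | inj₂ e-uncovered =
    d≢f (covered-unique pd pf (covered-if-other-not covers (d≢e ∘ sym) e-uncovered)
                              (covered-if-other-not covers e≢f e-uncovered))

-- n ≥ 6

terminal-matching : 6 ≤ n → {S : List (KV n)} → Terminal S → IsMatching S
terminal-matching {n} 6≤n {S} T = unique-pairwise-matching (Terminal.unique T) disjoint
  where
  disjoint : ∀ {x z} → x ∈ S → z ∈ S → x ≢ z → ¬ Meet x z
  disjoint {x} {z} x∈S z∈S x≢z x∩z
    with 3≤∣p∣⇒distinct₃ (∁ (proj₁ x ∪ proj₁ z))
           (≤-trans (∸-mono 6≤n (meet⇒∣u∪v∣≤3 x∩z)) (≤-reflexive (sym (∣∁p∣≡n∸∣p∣ (proj₁ x ∪ proj₁ z)))))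
  ... | d , e , f , d≢e , d≢f , e≢f , d∉ , e∉ , f∉ =
    no-three (terminal-covers T) (covered-outside-unique T x∈S z∈S x≢z x∩z)
             d≢e d≢f e≢f (x∈∁p⇒x∉p d∉) (x∈∁p⇒x∉p e∉) (x∈∁p⇒x∉p f∉)

terminal-length-≥6 : 6 ≤ n → {S : List (KV n)} → Terminal S → length S ≡ n / 2
terminal-length-≥6 6≤n T = matching-length (terminal-matching 6≤n T) (terminal-covers T)

shift : KV n → KV (2 + n)
shift (s , ∣s∣≡2) = outside ∷ outside ∷ s , ∣s∣≡2

0≢1 : _≢_ {A = Fin (2 + n)} zero (suc zero)
0≢1 ()

first-pair : KV (2 + n)
first-pair = pair zero (suc zero) 0≢1

standard-matching : (n : ℕ) → List (KV n)
standard-matching zero          = []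
standard-matching (suc zero)    = []
standard-matching (suc (suc n)) = first-pair ∷ map shift (standard-matching n)

shift-disjoint : {u v : KV n} → ¬ Meet u v → ¬ Meet (shift u) (shift v)
shift-disjoint u#v (meetAt (suc (suc k)) (there (there k∈u)) (there (there k∈v))) = u#v (meetAt k k∈u k∈v)

first-pair-disjoint : (v : KV n) → ¬ Meet first-pair (shift v)
first-pair-disjoint v (meetAt (suc (suc k)) k∈first (there (there _))) with ∈pair⁻ 0≢1 k∈first
... | inj₁ ()
... | inj₂ ()

standard-matching-isMatching : (n : ℕ) → IsMatching (standard-matching n)
standard-matching-isMatching zero          = []
standard-matching-isMatching (suc zero)    = []
standard-matching-isMatching (suc (suc n)) =
  Allₚ.map⁺ (All.universal first-pair-disjoint (standard-matching n)) ∷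
  AllPairsₚ.map⁺ (AllPairs.map shift-disjoint (standard-matching-isMatching n))

standard-matching-covers : (n : ℕ) → CoversAllButOne (standard-matching n)
standard-matching-covers (suc zero)    {zero}        {zero}        0≢0 = ⊥-elim (0≢0 refl)
standard-matching-covers (suc (suc n)) {zero}                      _   = inj₁ (first-pair , here refl , i∈pair 0≢1)
standard-matching-covers (suc (suc n)) {suc zero}                  _   = inj₁ (first-pair , here refl , j∈pair 0≢1)
standard-matching-covers (suc (suc n)) {suc (suc i)} {zero}        _   = inj₂ (first-pair , here refl , i∈pair 0≢1)
standard-matching-covers (suc (suc n)) {suc (suc i)} {suc zero}    _   = inj₂ (first-pair , here refl , j∈pair 0≢1)
standard-matching-covers (suc (suc n)) {suc (suc i)} {suc (suc j)} i≢j =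
  ⊎-map shifted shifted (standard-matching-covers n (λ i≡j → i≢j (cong (λ k → suc (suc k)) i≡j)))
  where
  shifted : ∀ {k} → Covered (standard-matching n) k → Covered (standard-matching (suc (suc n))) (suc (suc k))
  shifted (w , w∈S , k∈w) = shift w , there (∈-map⁺ shift w∈S) , there (there k∈w)

standard-matching-length : (n : ℕ) → length (standard-matching n) ≡ n / 2
standard-matching-length n = matching-length (standard-matching-isMatching n) (standard-matching-covers n)

standard-matching-terminal : 6 ≤ n → Terminal (standard-matching n)
standard-matching-terminal {n} 6≤n =
  matching-terminal (standard-matching-isMatching n) (standard-matching-covers n)
    (subst (3 ≤_) (sym (standard-matching-length n)) (/-monoˡ-≤ 2 6≤n))

-- The Petersen graph K(5,2)

petersen-terminal-has-meeting-pair : {S : List (KV 5)} → Terminal S → HasMeetingPair S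
petersen-terminal-has-meeting-pair T with matching⊎meeting-pair (Terminal.unique T)
... | inj₁ matching =
  ⊥-elim (matching-of-two-not-terminal matching (matching-length matching (terminal-covers T)) T)
... | inj₂ meeting  = meeting

petersen-terminal-misses-point : {S : List (KV 5)} → Terminal S → ∃ λ h → ¬ Covered S h
petersen-terminal-misses-point T with petersen-terminal-has-meeting-pair T
... | x , z , x∈S , z∈S , x≢z , x∩z
  with 2≤∣p∣⇒distinct₂ (∁ (proj₁ x ∪ proj₁ z))
         (≤-trans (∸-mono (≤-refl {5}) (meet⇒∣u∪v∣≤3 x∩z)) (≤-reflexive (sym (∣∁p∣≡n∸∣p∣ (proj₁ x ∪ proj₁ z)))))
...   | d , e , d≢e , d∉ , e∉
  with one-of-two-uncovered (terminal-covers T) (covered-outside-unique T x∈S z∈S x≢z x∩z)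
         d≢e (x∈∁p⇒x∉p d∉) (x∈∁p⇒x∉p e∉)
...     | inj₁ d-uncovered = d , d-uncovered
...     | inj₂ e-uncovered = e , e-uncovered

petersen-partition : {v m : KV 5} {h : Fin 5} → ¬ Meet v m → h ∉v v → h ∉v m → ∀ k → k ∈v v ⊎ k ∈v m ⊎ k ≡ h
petersen-partition {v} {m} {h} v#m h∉v h∉m k with x∈p∪q⁻ (proj₁ v) (proj₁ m ∪ ⁅ h ⁆) k∈v∪m∪h
  where
  m∩h-empty : Empty (proj₁ m ∩ ⁅ h ⁆)
  m∩h-empty (l , l∈m∩h) with x∈p∩q⁻ (proj₁ m) ⁅ h ⁆ l∈m∩h
  ... | l∈m , l∈h = h∉m (subst (_∈v m) (x∈⁅y⁆⇒x≡y h l∈h) l∈m)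
  v∩m∪h-empty : Empty (proj₁ v ∩ (proj₁ m ∪ ⁅ h ⁆))
  v∩m∪h-empty (l , l∈v∩) with x∈p∩q⁻ (proj₁ v) (proj₁ m ∪ ⁅ h ⁆) l∈v∩
  ... | l∈v , l∈m∪h with x∈p∪q⁻ (proj₁ m) ⁅ h ⁆ l∈m∪h
  ...   | inj₁ l∈m = v#m (meetAt l l∈v l∈m)
  ...   | inj₂ l∈h = h∉v (subst (_∈v v) (x∈⁅y⁆⇒x≡y h l∈h) l∈v)
  ∣v∪m∪h∣≡5 : ∣ proj₁ v ∪ (proj₁ m ∪ ⁅ h ⁆) ∣ ≡ 5
  ∣v∪m∪h∣≡5 = begin
    ∣ proj₁ v ∪ (proj₁ m ∪ ⁅ h ⁆) ∣         ≡⟨ Empty[p∩q]⇒∣p∪q∣≡∣p∣+∣q∣ (proj₁ v) _ v∩m∪h-empty ⟩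
    ∣ proj₁ v ∣ + ∣ proj₁ m ∪ ⁅ h ⁆ ∣
      ≡⟨ cong (∣ proj₁ v ∣ +_) (Empty[p∩q]⇒∣p∪q∣≡∣p∣+∣q∣ (proj₁ m) ⁅ h ⁆ m∩h-empty) ⟩
    ∣ proj₁ v ∣ + (∣ proj₁ m ∣ + ∣ ⁅ h ⁆ ∣) ≡⟨ cong₂ _+_ (proj₂ v) (cong₂ _+_ (proj₂ m) (∣⁅x⁆∣≡1 h)) ⟩
    5                                       ∎
    where open ≡-Reasoning
  k∈v∪m∪h : k ∈ₛ proj₁ v ∪ (proj₁ m ∪ ⁅ h ⁆)
  k∈v∪m∪h = subst (k ∈ₛ_) (sym (∣p∣≡n⇒p≡⊤ ∣v∪m∪h∣≡5)) ∈⊤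
... | inj₁ k∈v = inj₁ k∈v
... | inj₂ k∈m∪h with x∈p∪q⁻ (proj₁ m) ⁅ h ⁆ k∈m∪h
...   | inj₁ k∈m = inj₂ (inj₁ k∈m)
...   | inj₂ k∈h = inj₂ (inj₂ (x∈⁅y⁆⇒x≡y h k∈h))

petersen-terminal-contains-avoiding : {S : List (KV 5)} → Terminal S → ∀ {h} → ¬ Covered S h →
                                      ∀ {v} → h ∉v v → v ∈ S
petersen-terminal-contains-avoiding {S} T {h} h-uncovered {v} h∉v with Membership._∈?_ _≟v_ v S
... | yes v∈S = v∈S
... | no v∉S with Terminal.outer-geodesic T v∉S
...   | m , w , m∈S , w∈S , geodesic v#m m#w _ _ = subst (_∈ S) w≡v w∈S
  where
  w⊆v : proj₁ w ⊆ proj₁ v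
  w⊆v {k} k∈w with petersen-partition v#m h∉v (λ h∈m → h-uncovered (m , m∈S , h∈m)) k
  ... | inj₁ k∈v         = k∈v
  ... | inj₂ (inj₁ k∈m)  = ⊥-elim (m#w (meetAt k k∈m k∈w))
  ... | inj₂ (inj₂ refl) = ⊥-elim (h-uncovered (w , w∈S , k∈w))
  w≡v : w ≡ v
  w≡v = KV-≡ (⊆∧∣p∣≡∣q∣⇒p≡q w⊆v (trans (proj₂ w) (sym (proj₂ v))))

pattern I = inside
pattern O = outside

vertices₅ : List (KV 5)
vertices₅ =
  (I ∷ I ∷ O ∷ O ∷ O ∷ [] , refl) ∷ (I ∷ O ∷ I ∷ O ∷ O ∷ [] , refl) ∷ (I ∷ O ∷ O ∷ I ∷ O ∷ [] , refl) ∷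
  (I ∷ O ∷ O ∷ O ∷ I ∷ [] , refl) ∷ (O ∷ I ∷ I ∷ O ∷ O ∷ [] , refl) ∷ (O ∷ I ∷ O ∷ I ∷ O ∷ [] , refl) ∷
  (O ∷ I ∷ O ∷ O ∷ I ∷ [] , refl) ∷ (O ∷ O ∷ I ∷ I ∷ O ∷ [] , refl) ∷ (O ∷ O ∷ I ∷ O ∷ I ∷ [] , refl) ∷
  (O ∷ O ∷ O ∷ I ∷ I ∷ [] , refl) ∷ []

vertices₅-unique : Unique vertices₅
vertices₅-unique = toWitness {a? = UniqueDec.unique? _≟v_ vertices₅} _

listed : (v : KV 5) → {True (Membership._∈?_ _≟v_ v vertices₅)} → v ∈ vertices₅
listed v {v∈} = toWitness v∈

vertices₅-complete : (v : KV 5) → v ∈ vertices₅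
vertices₅-complete v@(I ∷ I ∷ O ∷ O ∷ O ∷ [] , refl) = listed v
vertices₅-complete v@(I ∷ O ∷ I ∷ O ∷ O ∷ [] , refl) = listed v
vertices₅-complete v@(I ∷ O ∷ O ∷ I ∷ O ∷ [] , refl) = listed v
vertices₅-complete v@(I ∷ O ∷ O ∷ O ∷ I ∷ [] , refl) = listed v
vertices₅-complete v@(O ∷ I ∷ I ∷ O ∷ O ∷ [] , refl) = listed v
vertices₅-complete v@(O ∷ I ∷ O ∷ I ∷ O ∷ [] , refl) = listed v
vertices₅-complete v@(O ∷ I ∷ O ∷ O ∷ I ∷ [] , refl) = listed v
vertices₅-complete v@(O ∷ O ∷ I ∷ I ∷ O ∷ [] , refl) = listed v
vertices₅-complete v@(O ∷ O ∷ I ∷ O ∷ I ∷ [] , refl) = listed v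
vertices₅-complete v@(O ∷ O ∷ O ∷ I ∷ I ∷ [] , refl) = listed v
vertices₅-complete (O ∷ O ∷ O ∷ O ∷ I ∷ [] , ())
vertices₅-complete (O ∷ O ∷ O ∷ O ∷ O ∷ [] , ())

avoiding : Fin 5 → List (KV 5)
avoiding h = filter (λ v → ¬? (h ∈? proj₁ v)) vertices₅

avoiding-unique : (h : Fin 5) → Unique (avoiding h)
avoiding-unique h = Uniqueₚ.filter⁺ (λ v → ¬? (h ∈? proj₁ v)) vertices₅-unique

∈avoiding⁺ : {h : Fin 5} {v : KV 5} → h ∉v v → v ∈ avoiding h
∈avoiding⁺ {h} {v} h∉v = ∈-filter⁺ (λ v → ¬? (h ∈? proj₁ v)) (vertices₅-complete v) h∉v

∈avoiding⁻ : {h : Fin 5} {v : KV 5} → v ∈ avoiding h → h ∉v v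
∈avoiding⁻ {h} v∈ = proj₂ (∈-filter⁻ (λ v → ¬? (h ∈? proj₁ v)) v∈)

length-avoiding : (h : Fin 5) → length (avoiding h) ≡ 6
length-avoiding zero                         = refl
length-avoiding (suc zero)                   = refl
length-avoiding (suc (suc zero))             = refl
length-avoiding (suc (suc (suc zero)))       = refl
length-avoiding (suc (suc (suc (suc zero)))) = refl

petersen-terminal-length : {S : List (KV 5)} → Terminal S → length S ≡ 6
petersen-terminal-length {S} T with petersen-terminal-misses-point T
... | h , h-uncovered =
  trans (↭-length (∼bag⇒↭ (unique∧set⇒bag (Terminal.unique T) (avoiding-unique h) same-members)))
        (length-avoiding h)
  where
  same-members : ∀ {v} → (v ∈ S) ⇔ (v ∈ avoiding h)
  same-members = mk⇔ (λ v∈S → ∈avoiding⁺ (λ h∈v → h-uncovered (_ , v∈S , h∈v)))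
                     (λ v∈ → petersen-terminal-contains-avoiding T h-uncovered (∈avoiding⁻ v∈))

avoiding-geodesic-free : (h : Fin 5) → GeodesicFree (avoiding h)
avoiding-geodesic-free h {a} {m} {b} a∈ m∈ b∈ (geodesic a#m m#b (meetAt k k∈a k∈b) a≢b) with pairViewAt b k∈b
... | pairWith q q≢k with petersen-partition {h = h} a#m (∈avoiding⁻ a∈) (∈avoiding⁻ m∈) q
...   | inj₁ q∈a         = a≢b (sym (pair-unique q≢k q∈a k∈a))
...   | inj₂ (inj₁ q∈m)  = m#b (meetAt q q∈m (i∈pair q≢k))
...   | inj₂ (inj₂ refl) = ∈avoiding⁻ b∈ (i∈pair q≢k)

avoiding-outer-geodesic : (h : Fin 5) {u : KV 5} → u ∉ avoiding h →
                          ∃₂ λ m w → m ∈ avoiding h × w ∈ avoiding h × Geodesic u m w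
avoiding-outer-geodesic h {u} u∉ with h ∈? proj₁ u
... | no h∉u  = ⊥-elim (u∉ (∈avoiding⁺ h∉u))
... | yes h∈u with pairViewAt u h∈u
...   | pairWith t t≢h
  with 3≤∣p∣⇒distinct₃ (∁ (⁅ t ⁆ ∪ ⁅ h ⁆))
         (≤-reflexive (sym (trans (∣∁p∣≡n∸∣p∣ (⁅ t ⁆ ∪ ⁅ h ⁆)) (cong (5 ∸_) (proj₂ (pair t h t≢h))))))
...     | p , q , r , p≢q , p≢r , q≢r , p∉u , q∉u , r∉u
  with ∉⁅i⁆∪⁅j⁆⇒≢ (x∈∁p⇒x∉p p∉u) | ∉⁅i⁆∪⁅j⁆⇒≢ (x∈∁p⇒x∉p q∉u) | ∉⁅i⁆∪⁅j⁆⇒≢ (x∈∁p⇒x∉p r∉u)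
...       | p≢t , p≢h | q≢t , q≢h | r≢t , r≢h =
  pair p q p≢q , pair t r t≢r , ∈avoiding⁺ h∉m , ∈avoiding⁺ h∉w ,
  geodesic (pair-disjoint p≢q (x∈∁p⇒x∉p p∉u) (x∈∁p⇒x∉p q∉u) ∘ meet-sym)
           (pair-disjoint p≢q (≢⇒∉⁅i⁆∪⁅j⁆ p≢t p≢r) (≢⇒∉⁅i⁆∪⁅j⁆ q≢t q≢r))
           (meetAt t (i∈pair t≢h) (i∈pair t≢r))
           (λ u≡w → h∉w (subst (h ∈v_) u≡w (j∈pair t≢h)))
  where
  t≢r : t ≢ r
  t≢r = r≢t ∘ sym
  h∉m : h ∉v pair p q p≢q
  h∉m = ≢⇒∉⁅i⁆∪⁅j⁆ (p≢h ∘ sym) (q≢h ∘ sym)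
  h∉w : h ∉v pair t r t≢r
  h∉w = ≢⇒∉⁅i⁆∪⁅j⁆ (t≢h ∘ sym) (r≢h ∘ sym)

avoiding-terminal : (h : Fin 5) → Terminal (avoiding h)
avoiding-terminal h = record
  { unique         = avoiding-unique h
  ; geodesic-free  = avoiding-geodesic-free h
  ; outer-geodesic = avoiding-outer-geodesic h
  }

constant-terminal-order : 5 ≤ n → ∀ {k} (S₀ : List (KV n)) → Terminal S₀ → length S₀ ≡ k →
                          (∀ {S} → Terminal S → length S ≡ k) → IsTp n k × IsTpMinus n k
constant-terminal-order {n} 5≤n {k} S₀ T₀ length-S₀ length-terminal = (witness , upper) , (witness , lower)
  where
  witness : Σ (List (KV n)) λ S → IsTerminal S × length S ≡ k
  witness = S₀ , Terminal⇒IsTerminal 5≤n T₀ , length-S₀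
  upper : ∀ S → IsTerminal S → length S ≤ k
  upper S isTerminal = ≤-reflexive (length-terminal (IsTerminal⇒Terminal 5≤n isTerminal))
  lower : ∀ S → IsTerminal S → k ≤ length S
  lower S isTerminal = ≤-reflexive (sym (length-terminal (IsTerminal⇒Terminal 5≤n isTerminal)))

theorem4p2 : (n : ℕ) → 5 ≤ n →
    (n ≡ 5 → IsTp n 6 × IsTpMinus n 6) ×
    (6 ≤ n → IsTp n (n / 2) × IsTpMinus n (n / 2))
theorem4p2 n 5≤n = petersen , larger
  where
  petersen : n ≡ 5 → IsTp n 6 × IsTpMinus n 6
  petersen refl = constant-terminal-order 5≤n (avoiding zero) (avoiding-terminal zero) (length-avoiding zero)
                    petersen-terminal-length
  larger : 6 ≤ n → IsTp n (n / 2) × IsTpMinus n (n / 2)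
  larger 6≤n = constant-terminal-order 5≤n (standard-matching n) (standard-matching-terminal 6≤n)
                 (standard-matching-length n) (terminal-length-≥6 6≤n)
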